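{- Let $G$ and $H$ be two connected graphs of order at least two, and let $n_1$ denote the order of $G$. If $G\odot H\not\cong K_{n_1}\odot P_2$ and $G\odot H\not\cong K_{n_1}\odot P_3$, then $$\dim(G\odot H)\ge \frac{n_1}{n_1-1}\,pd(G).$$
   Context: $K_n$ and $P_n$ denote the complete graph and path of order $n$. For a connected graph $F$ and an ordered set $S=\{s_1,\dots,s_k\}$ of vertices, $r(v|S)=(d(v,s_1),\dots,d(v,s_k))$ with $d$ the shortest-path distance; $S$ is a resolving set if $r(u|S)\neq r(v|S)$ for all distinct vertices $u,v$; $\dim(F)$ is the minimum cardinality of a resolving set. For an ordered partition $\Pi=\{P_1,\dots,P_t\}$ of $V(F)$, $r(v|\Pi)=(d(v,P_1),\dots,d(v,P_t))$ where $d(v,P_i)=\min_{u\in P_i}d(v,u)$; $\Pi$ is resolving if $r(u|\Pi)\ne r(v|\Pi)$ for all distinct $u,v$; $pd(F)$ is the minimum number of sets in a resolving partition. For graphs $G$ of order $n_1$ (vertices $v_1,\dots,v_{n_1}$) and $H$, the corona product $G\odot H$ is obtained from one copy of $G$ and $n_1$ copies $H_1,\dots,H_{n_1}$ of $H$ by joining $v_i$ to every vertex of $H_i$. -}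

module Defs where

open import Data.Nat using (ℕ; zero; suc; _≤_)
open import Data.Fin using (Fin; toℕ)
open import Data.Product using (Σ; ∃; _×_; _,_)
open import Data.Sum using (_⊎_; inj₁; inj₂)
open import Data.Empty using (⊥)
open import Relation.Nullary using (¬_)
open import Relation.Binary.PropositionalEquality using (_≡_; _≢_; refl; sym)
open import Function.Bundles using (_↔_; Inverse)

record Graph (V : Set) : Set₁ where
  field
    Adj    : V → V → Set
    symm   : ∀ {u v} → Adj u v → Adj v u
    irrefl : ∀ {v} → ¬ Adj v v
open Graph public

data Walk {V : Set} (G : Graph V) : V → V → ℕ → Set where
  nil  : ∀ {v} → Walk G v v 0
  cons : ∀ {u w v k} → Adj G u w → Walk G w v k → Walk G u v (suc k)

Connected : ∀ {V} → Graph V → Set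
Connected {V} G = ∀ (u v : V) → ∃ λ k → Walk G u v k

Dist : ∀ {V} → Graph V → V → V → ℕ → Set
Dist G u v k = Walk G u v k × (∀ m → Walk G u v m → k ≤ m)

SetDist : ∀ {V} → Graph V → (V → Set) → V → ℕ → Set
SetDist {V} G P v k =
  Σ V (λ u → P u × Dist G v u k) × (∀ u m → P u → Dist G v u m → k ≤ m)

OrderedSet : Set → ℕ → Set
OrderedSet V k = Σ (Fin k → V) λ S → ∀ {i j} → S i ≡ S j → i ≡ j

IsResolvingSet : ∀ {V k} → Graph V → OrderedSet V k → Set
IsResolvingSet {V} {k} G (S , _) =
  ∀ (u v : V) → u ≢ v →
    Σ (Fin k) λ i → Σ ℕ λ a → Σ ℕ λ b →
      Dist G u (S i) a × Dist G v (S i) b × a ≢ b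

IsMetricDim : ∀ {V} → Graph V → ℕ → Set
IsMetricDim {V} G d =
  Σ (OrderedSet V d) (IsResolvingSet G) ×
  (∀ k (S : OrderedSet V k) → IsResolvingSet G S → d ≤ k)

-- an ordered partition {P_1..P_t} of V into nonempty classes,
-- given by the class-assignment map (P_i = { v | Π v ≡ i })
OrderedPartition : Set → ℕ → Set
OrderedPartition V t = Σ (V → Fin t) λ Π → ∀ (i : Fin t) → Σ V λ v → Π v ≡ i

IsResolvingPartition : ∀ {V t} → Graph V → OrderedPartition V t → Set
IsResolvingPartition {V} {t} G (Π , _) =
  ∀ (u v : V) → u ≢ v →
    Σ (Fin t) λ i → Σ ℕ λ a → Σ ℕ λ b →
      SetDist G (λ w → Π w ≡ i) u a × SetDist G (λ w → Π w ≡ i) v b × a ≢ b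

IsPartitionDim : ∀ {V} → Graph V → ℕ → Set
IsPartitionDim {V} G p =
  Σ (OrderedPartition V p) (IsResolvingPartition G) ×
  (∀ t (Π : OrderedPartition V t) → IsResolvingPartition G Π → p ≤ t)

K : (n : ℕ) → Graph (Fin n)
K n = record { Adj = λ i j → i ≢ j ; symm = λ p q → p (sym q) ; irrefl = λ p → p refl }

PAdj : ∀ {n} → Fin n → Fin n → Set
PAdj i j = (toℕ j ≡ suc (toℕ i)) ⊎ (toℕ i ≡ suc (toℕ j))

n≢1+n : ∀ n → n ≢ suc n
n≢1+n zero ()
n≢1+n (suc n) e = n≢1+n n (cong-pred e)
  where
  cong-pred : ∀ {a b : ℕ} → suc a ≡ suc b → a ≡ b
  cong-pred refl = refl

P-irrefl : ∀ {n} {i : Fin n} → ¬ PAdj i i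
P-irrefl {i = i} (inj₁ e) = n≢1+n (toℕ i) e
P-irrefl {i = i} (inj₂ e) = n≢1+n (toℕ i) e

P : (n : ℕ) → Graph (Fin n)
P n = record
  { Adj = PAdj
  ; symm = λ { (inj₁ e) → inj₂ e ; (inj₂ e) → inj₁ e }
  ; irrefl = P-irrefl }

-- vertices of G ⊙ H: inj₁ i = v_i of G, inj₂ (i , h) = vertex h of the copy H_i
CoronaAdj : ∀ {n₁ n₂} → Graph (Fin n₁) → Graph (Fin n₂) →
            (Fin n₁ ⊎ (Fin n₁ × Fin n₂)) → (Fin n₁ ⊎ (Fin n₁ × Fin n₂)) → Set
CoronaAdj G H (inj₁ i) (inj₁ j) = Adj G i j
CoronaAdj G H (inj₁ i) (inj₂ (j , _)) = i ≡ j
CoronaAdj G H (inj₂ (i , _)) (inj₁ j) = i ≡ j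
CoronaAdj G H (inj₂ (i , h)) (inj₂ (j , h')) = i ≡ j × Adj H h h'

Corona-symm : ∀ {n₁ n₂} (G : Graph (Fin n₁)) (H : Graph (Fin n₂)) {u v} →
              CoronaAdj G H u v → CoronaAdj G H v u
Corona-symm G H {inj₁ i} {inj₁ j} a = symm G a
Corona-symm G H {inj₁ i} {inj₂ _} e = sym e
Corona-symm G H {inj₂ _} {inj₁ j} e = sym e
Corona-symm G H {inj₂ _} {inj₂ _} (e , a) = sym e , symm H a

Corona-irrefl : ∀ {n₁ n₂} (G : Graph (Fin n₁)) (H : Graph (Fin n₂)) {v} →
                ¬ CoronaAdj G H v v
Corona-irrefl G H {inj₁ i} a = irrefl G a
Corona-irrefl G H {inj₂ _} (_ , a) = irrefl H a

_⊙_ : ∀ {n₁ n₂} → Graph (Fin n₁) → Graph (Fin n₂) → Graph (Fin n₁ ⊎ (Fin n₁ × Fin n₂))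
G ⊙ H = record { Adj = CoronaAdj G H ; symm = λ {u} {v} → Corona-symm G H {u} {v} ; irrefl = λ {v} → Corona-irrefl G H {v} }

_≅_ : ∀ {V W} → Graph V → Graph W → Set
_≅_ {V} {W} G G' = Σ (V ↔ W) λ φ →
  ∀ u v → (Adj G u v → Adj G' (Inverse.to φ u) (Inverse.to φ v)) ×
          (Adj G' (Inverse.to φ u) (Inverse.to φ v) → Adj G u v)

module Submission where

-- Let S be a metric basis of G ⊙ H of size d.  Walks leaving a copy Hᵢ pass through its root
-- vᵢ, so the vertices of Hᵢ are equidistant from everything outside Hᵢ: every copy contains a
-- landmark of S, and n₁ ≤ d.  Classically, either
--  * G has an induced path u - v - w: merging u and v in the singleton partition still
--    resolves G, so pd(G) ≤ n₁ - 1 and n₁·pd(G) ≤ n₁(n₁-1) ≤ (n₁-1)·d; or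
--  * G is complete, so pd(G) ≤ n₁.  If every copy holds two landmarks then 2n₁ ≤ d and
--    n₁·pd(G) ≤ n₁² ≤ (n₁-1)·2n₁.  Otherwise a copy Hᵢ holds a single landmark h₀ and any two
--    other vertices of Hᵢ differ in adjacency to h₀; so H has at most three vertices, is P₂
--    or P₃, and G ⊙ H ≅ K_{n₁} ⊙ P₂ or K_{n₁} ⊙ P₃, which the hypotheses exclude.
-- Distances and adjacency are undecidable here, so the argument runs in the double-negation
-- monad; the conclusion, a decidable inequality, is stable under double negation.

open import Defs
open import Data.Nat using (ℕ; zero; suc; _≤_; _<_; _*_; _∸_; _+_; z≤n; s≤s; _≤?_)
open import Data.Nat.Properties
  using (≤-refl; ≤-trans; ≤-antisym; ≰⇒>; m≤n⇒m≤1+n; m≤m+n; *-comm; *-monoʳ-≤;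
         module ≤-Reasoning)
open import Data.Nat.Induction using (<-rec)
open import Data.Nat.Solver using (module +-*-Solver)
open import Data.Fin using (Fin; zero; suc; _≟_; punchIn; punchOut; splitAt; join)
open import Data.Fin.Properties
  using (any?; all?; ¬∀⟶∃¬; injective⇒≤; join-splitAt; sequence; punchOut-injective;
         punchOut-cong; punchOut-punchIn; punchInᵢ≢i; punchIn-injective)
open import Data.Product using (Σ; ∃; _×_; _,_; proj₁; proj₂)
open import Data.Sum using (_⊎_; inj₁; inj₂)
open import Data.Empty using (⊥; ⊥-elim)
open import Effect.Monad using (RawMonad)
open import Function.Base using (_∘_)
open import Function.Bundles using (Inverse; mk↔ₛ′; _⇔_; mk⇔; Equivalence)
open import Level using (0ℓ)
open import Relation.Nullary using (¬_; Dec; yes; no)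
open import Relation.Nullary.Decidable using (decidable-stable; ¬¬-excluded-middle; ¬?; _×-dec_)
open import Relation.Nullary.Negation using (¬¬-Monad)
open import Relation.Binary.PropositionalEquality using (_≡_; _≢_; refl; sym; trans; cong; subst; subst₂)

open RawMonad (¬¬-Monad {a = 0ℓ}) using (pure; _>>=_; rawApplicative)

¬¬-∀Fin : ∀ {n} {P : Fin n → Set} → (∀ i → ¬ ¬ P i) → ¬ ¬ (∀ i → P i)
¬¬-∀Fin = sequence rawApplicative

¬¬-→ : ∀ {A B : Set} → (A → ¬ ¬ B) → ¬ ¬ (A → B)
¬¬-→ f = ¬¬-excluded-middle >>= λ where
  (yes a) → f a >>= λ b → pure (λ _ → b)
  (no ¬a) → pure (λ a → ⊥-elim (¬a a))

Least : (ℕ → Set) → ℕ → Set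
Least Q k = Q k × (∀ m → Q m → k ≤ m)

¬¬-least : (Q : ℕ → Set) → ∀ m → Q m → ¬ ¬ Σ ℕ (Least Q)
¬¬-least Q = <-rec (λ m → Q m → ¬ ¬ Σ ℕ (Least Q)) step
  where
  step : ∀ m → (∀ {m'} → m' < m → Q m' → ¬ ¬ Σ ℕ (Least Q)) → Q m → ¬ ¬ Σ ℕ (Least Q)
  step m smaller qm = ¬¬-excluded-middle {A = Σ ℕ λ m' → m' < m × Q m'} >>= λ where
    (yes (m' , m'<m , qm')) → smaller m'<m qm'
    (no noSmaller) → pure (m , qm , λ m' qm' →
      decidable-stable (m ≤? m') (λ m≰m' → noSmaller (m' , ≰⇒> m≰m' , qm')))

one-of-two : ∀ {A B : Set} → Dec A → Dec B → ¬ (A ⇔ B) → (A × ¬ B) ⊎ (¬ A × B)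
one-of-two (yes a) (yes b) a≢b = ⊥-elim (a≢b (mk⇔ (λ _ → b) (λ _ → a)))
one-of-two (yes a) (no ¬b) _   = inj₁ (a , ¬b)
one-of-two (no ¬a) (yes b) _   = inj₂ (¬a , b)
one-of-two (no ¬a) (no ¬b) a≢b = ⊥-elim (a≢b (mk⇔ (⊥-elim ∘ ¬a) (⊥-elim ∘ ¬b)))

no-three-inequivalent : ∀ {A B C : Set} → Dec A → Dec B → Dec C →
  ¬ (A ⇔ B) → ¬ (A ⇔ C) → ¬ (B ⇔ C) → ⊥
no-three-inequivalent a? b? c? a≢b a≢c b≢c with one-of-two a? b? a≢b | c?
... | inj₁ (a , _)  | yes c = a≢c (mk⇔ (λ _ → c) (λ _ → a))
... | inj₁ (_ , ¬b) | no ¬c = b≢c (mk⇔ (⊥-elim ∘ ¬b) (⊥-elim ∘ ¬c))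
... | inj₂ (_ , b)  | yes c = b≢c (mk⇔ (λ _ → c) (λ _ → b))
... | inj₂ (¬a , _) | no ¬c = a≢c (mk⇔ (⊥-elim ∘ ¬a) (⊥-elim ∘ ¬c))

walk₀-trivial : ∀ {V} {G : Graph V} {x y} → Walk G x y 0 → x ≡ y
walk₀-trivial nil = refl

walk₁-edge : ∀ {V} {G : Graph V} {x y} → Walk G x y 1 → Adj G x y
walk₁-edge (cons xy nil) = xy

¬¬-setDist : ∀ {V} (G : Graph V) (P : V → Set) {x u m} → P u → Walk G x u m →
  ¬ ¬ Σ ℕ (SetDist G P x)
¬¬-setDist {V} G P {x} {u} {m} pu walk = ¬¬-least Reaches m (u , pu , walk) >>= λ
  { (k , (u' , pu' , walk') , least) →
      pure (k , (u' , pu' , walk' , λ m' w → least m' (u' , pu' , w))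
              , λ u'' m'' pu'' dist → least m'' (u'' , pu'' , proj₁ dist)) }
  where
  Reaches : ℕ → Set
  Reaches k = Σ V λ z → P z × Walk G x z k

dist-mono : ∀ {V} {G : Graph V} {x x' y a b} → Dist G x y a → Dist G x' y b →
  (∀ m → Walk G x y m → Σ ℕ λ m' → m' ≤ m × Walk G x' y m') → b ≤ a
dist-mono (walk , _) (_ , shortest) shorten with shorten _ walk
... | (m' , m'≤a , walk') = ≤-trans (shortest m' walk') m'≤a

Separates : ∀ {V} → Graph V → (V → Set) → V → V → Set
Separates G P x y = Σ ℕ λ a → Σ ℕ λ b → SetDist G P x a × SetDist G P y b × a ≢ b

separates-sym : ∀ {V} {G : Graph V} {P x y} → Separates G P x y → Separates G P y x
separates-sym (a , b , da , db , a≢b) = b , a , db , da , a≢b ∘ sym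

module _ {V : Set} (G : Graph V) (connected : Connected G) where

  singleton-separates : (P : V → Set) {x : V} → P x → (∀ z → P z → z ≡ x) →
    ∀ y → y ≢ x → ¬ ¬ Separates G P x y
  singleton-separates P {x} px only-x y y≢x =
    ¬¬-setDist G P px (proj₂ (connected y x)) >>= λ where
      (b , db) → pure (0 , b , ((x , px , nil , λ _ _ → z≤n) , λ _ _ _ _ → z≤n) , db , y≢x ∘ at-x b db)
    where
    at-x : ∀ b → SetDist G P y b → 0 ≡ b → y ≡ x
    at-x .0 ((z , pz , walk , _) , _) refl = trans (walk₀-trivial walk) (only-x z pz)

  neighbour-separates : (P : V → Set) {w : V} → P w → (∀ z → P z → z ≡ w) →
    ∀ {u v} → Adj G v w → ¬ Adj G u w → ¬ ¬ Separates G P v u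
  neighbour-separates P {w} pw only-w {u} {v} vw u≁w =
    ¬¬-setDist G P pw (proj₂ (connected u w)) >>= λ where
      (b , db) → pure (1 , b , ((w , pw , cons vw nil , v-far) , λ z m pz d → v-far m (to-w z pz (proj₁ d)))
                      , db , u≁w ∘ adjacent b db)
    where
    to-w : ∀ z {m} → P z → Walk G v z m → Walk G v w m
    to-w z pz walk = subst (λ t → Walk G v t _) (only-w z pz) walk
    v-far : ∀ m → Walk G v w m → 1 ≤ m
    v-far zero walk = ⊥-elim (irrefl G (subst (λ t → Adj G t w) (walk₀-trivial walk) vw))
    v-far (suc m) _ = s≤s z≤n
    adjacent : ∀ b → SetDist G P u b → 1 ≡ b → Adj G u w
    adjacent .1 ((z , pz , walk , _) , _) refl = subst (Adj G u) (only-w z pz) (walk₁-edge walk)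

pd-bound : ∀ {n t p} (G : Graph (Fin n)) (Π : OrderedPartition (Fin n) t) → IsPartitionDim G p →
  (∀ x y → x ≢ y → ¬ ¬ Σ (Fin t) λ i → Separates G (λ z → proj₁ Π z ≡ i) x y) → p ≤ t
pd-bound {t = t} {p} G Π (_ , minimal) separate = decidable-stable (p ≤? t)
  (¬¬-∀Fin (λ x → ¬¬-∀Fin λ y → ¬¬-→ (separate x y)) >>= λ resolving → pure (minimal t Π resolving))

-- The partition into singletons resolves G, so pd(G) ≤ n.
pd≤order : ∀ {n p} (G : Graph (Fin n)) → Connected G → IsPartitionDim G p → p ≤ n
pd≤order G connected pdG = pd-bound G ((λ x → x) , λ i → i , refl) pdG λ x y x≢y →
  singleton-separates G connected (λ z → z ≡ x) refl (λ _ e → e) y (x≢y ∘ sym) >>= λ sep →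
  pure (x , sep)

InducedPath : ∀ {V} → Graph V → Set
InducedPath {V} G = Σ V λ u → Σ V λ v → Σ V λ w → Adj G u v × Adj G v w × u ≢ w × ¬ Adj G u w

-- Along an induced path u - v - w, the partition merging u and v and keeping every other
-- vertex as a singleton resolves G: {w} separates v from u.  Hence pd(G) ≤ n - 1.
module MergedPartition {n} (G : Graph (Fin (suc n))) (connected : Connected G)
  {u v w : Fin (suc n)} (uv : Adj G u v) (vw : Adj G v w) (u≢w : u ≢ w) (u≁w : ¬ Adj G u w) where

  v≢u : v ≢ u
  v≢u refl = irrefl G uv

  v≢w : v ≢ w
  v≢w refl = irrefl G vw

  -- Class of a vertex: v is sent to the class of u, the other vertices are renumbered.
  class : Fin (suc n) → Fin n
  class x with v ≟ x
  ... | yes _ = punchOut v≢u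
  ... | no v≢x = punchOut v≢x

  class-≢v : ∀ x (v≢x : v ≢ x) → class x ≡ punchOut v≢x
  class-≢v x v≢x with v ≟ x
  ... | yes v≡x = ⊥-elim (v≢x v≡x)
  ... | no _ = punchOut-cong v refl

  singleton-class : ∀ z → z ≢ u → z ≢ v → ∀ y → class y ≡ class z → y ≡ z
  singleton-class z z≢u z≢v y same = from-renumbering y (trans same (class-≢v z v≢z))
    where
    v≢z : v ≢ z
    v≢z = z≢v ∘ sym
    from-renumbering : ∀ y → class y ≡ punchOut v≢z → y ≡ z
    from-renumbering y same' with v ≟ y
    ... | yes refl = ⊥-elim (z≢u (sym (punchOut-injective v≢u v≢z same')))
    ... | no v≢y = punchOut-injective v≢y v≢z same'

  partition : OrderedPartition (Fin (suc n)) n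
  partition = class , λ c → punchIn v c ,
    trans (class-≢v (punchIn v c) (punchInᵢ≢i v c ∘ sym)) (trans (punchOut-cong v refl) (punchOut-punchIn v))

  InClass : Fin n → Fin (suc n) → Set
  InClass c z = class z ≡ c

  by-own-class : ∀ x y → x ≢ u → x ≢ v → x ≢ y → ¬ ¬ Σ (Fin n) λ c → Separates G (InClass c) x y
  by-own-class x y x≢u x≢v x≢y =
    singleton-separates G connected (InClass (class x)) refl (singleton-class x x≢u x≢v) y (x≢y ∘ sym)
      >>= λ sep → pure (class x , sep)

  v-from-u : ¬ ¬ Separates G (InClass (class w)) v u
  v-from-u = neighbour-separates G connected (InClass (class w)) refl
    (singleton-class w (u≢w ∘ sym) (v≢w ∘ sym)) vw u≁w

  -- If x or y lies outside {u, v}, its own class separates them; otherwise {x, y} = {u, v}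
  -- and the class {w} does.
  separate : ∀ x y → x ≢ y → ¬ ¬ Σ (Fin n) λ c → Separates G (InClass c) x y
  separate x y x≢y with x ≟ u | x ≟ v | y ≟ u | y ≟ v
  ... | no x≢u | no x≢v | _ | _ = by-own-class x y x≢u x≢v x≢y
  ... | _ | _ | no y≢u | no y≢v =
    by-own-class y x y≢u y≢v (x≢y ∘ sym) >>= λ (c , sep) → pure (c , separates-sym sep)
  ... | yes refl | _ | _ | yes refl = v-from-u >>= λ sep → pure (class w , separates-sym sep)
  ... | _ | yes refl | yes refl | _ = v-from-u >>= λ sep → pure (class w , sep)
  ... | yes refl | _ | yes refl | _ = ⊥-elim (x≢y refl)
  ... | _ | yes refl | _ | yes refl = ⊥-elim (x≢y refl)

pd-induced-path : ∀ {n p} (G : Graph (Fin (suc n))) → Connected G → InducedPath G →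
  IsPartitionDim G p → p ≤ n
pd-induced-path G connected (u , v , w , uv , vw , u≢w , u≁w) pdG = pd-bound G partition pdG separate
  where open MergedPartition G connected uv vw u≢w u≁w

Complete : ∀ {n} → Graph (Fin n) → Set
Complete {n} G = ∀ (a b : Fin n) → a ≢ b → Adj G a b

walk-shortcut : ∀ {V} (G : Graph V) → ¬ InducedPath G → ∀ {a b m} → Walk G a b m →
  ¬ ¬ (a ≡ b ⊎ Adj G a b)
walk-shortcut G noPath nil = pure (inj₁ refl)
walk-shortcut G noPath {a} {b} (cons {w = z} az rest) = walk-shortcut G noPath rest >>= λ where
  (inj₁ refl) → pure (inj₂ az)
  (inj₂ zb) → ¬¬-excluded-middle >>= λ where
    (yes ab) → pure (inj₂ ab)
    (no a≁b) → ¬¬-excluded-middle >>= λ where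
      (yes a≡b) → pure (inj₁ a≡b)
      (no a≢b) → ⊥-elim (noPath (a , z , b , az , zb , a≢b , a≁b))

¬¬-complete : ∀ {n} (G : Graph (Fin n)) → Connected G → ¬ InducedPath G → ¬ ¬ Complete G
¬¬-complete G connected noPath = ¬¬-∀Fin λ a → ¬¬-∀Fin λ b → ¬¬-→ λ a≢b →
  walk-shortcut G noPath (proj₂ (connected a b)) >>= λ where
    (inj₁ a≡b) → ⊥-elim (a≢b a≡b)
    (inj₂ ab) → pure ab

DistinguishedBy : ∀ {n} → Graph (Fin n) → Fin n → Set
DistinguishedBy {n} H h₀ =
  ∀ (a b : Fin n) → a ≢ b → a ≢ h₀ → b ≢ h₀ → ¬ (Adj H a h₀ ⇔ Adj H b h₀)

module Corona {n₁ n₂ : ℕ} (G : Graph (Fin n₁)) (H : Graph (Fin n₂)) where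

  Vertex : Set
  Vertex = Fin n₁ ⊎ (Fin n₁ × Fin n₂)

  InCopy : Fin n₁ → Vertex → Set
  InCopy i x = Σ (Fin n₂) λ h → x ≡ inj₂ (i , h)

  inCopy? : ∀ i x → Dec (InCopy i x)
  inCopy? i (inj₁ _) = no λ ()
  inCopy? i (inj₂ (j , h)) with j ≟ i
  ... | yes refl = yes (h , refl)
  ... | no j≢i = no λ { (_ , refl) → j≢i refl }

  copy-unique : ∀ {i j x} → InCopy i x → InCopy j x → i ≡ j
  copy-unique (_ , refl) (_ , refl) = refl

  position-injective : ∀ {i j h h'} → _≡_ {A = Vertex} (inj₂ (i , h)) (inj₂ (j , h')) → h ≡ h'
  position-injective refl = refl

  leave-copy : ∀ i h {x m} → ¬ InCopy i x → Walk (G ⊙ H) (inj₂ (i , h)) x m →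
    Σ ℕ λ l → l < m × Walk (G ⊙ H) (inj₁ i) x l
  leave-copy i h x∉Hᵢ nil = ⊥-elim (x∉Hᵢ (h , refl))
  leave-copy i h x∉Hᵢ (cons {w = inj₁ _} refl rest) = _ , ≤-refl , rest
  leave-copy i h x∉Hᵢ (cons {w = inj₂ (_ , h')} (refl , _) rest) with leave-copy i h' x∉Hᵢ rest
  ... | (l , l<m , walk) = l , m≤n⇒m≤1+n l<m , walk

  outside-distance-eq : ∀ i h h' {x a b} → ¬ InCopy i x →
    Dist (G ⊙ H) (inj₂ (i , h)) x a → Dist (G ⊙ H) (inj₂ (i , h')) x b → a ≡ b
  outside-distance-eq i h h' {x} x∉Hᵢ da db =
    ≤-antisym (dist-mono db da (via-root h' h)) (dist-mono da db (via-root h h'))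
    where
    via-root : ∀ h₁ h₂ m → Walk (G ⊙ H) (inj₂ (i , h₁)) x m →
      Σ ℕ λ m' → m' ≤ m × Walk (G ⊙ H) (inj₂ (i , h₂)) x m'
    via-root h₁ h₂ m walk with leave-copy i h₁ x∉Hᵢ walk
    ... | (l , l<m , walk') = suc l , l<m , cons refl walk'

  -- Inside Hᵢ the distance from (i,h) to (i,h₀), h ≠ h₀, is 1 or 2 according as h ~ h₀ or
  -- not; so it depends only on the adjacency of h to h₀.
  inside-distance-eq : ∀ i {h h' h₀ a b} → h ≢ h₀ → h' ≢ h₀ → (Adj H h h₀ ⇔ Adj H h' h₀) →
    Dist (G ⊙ H) (inj₂ (i , h)) (inj₂ (i , h₀)) a →
    Dist (G ⊙ H) (inj₂ (i , h')) (inj₂ (i , h₀)) b → a ≡ b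
  inside-distance-eq i {h} {h'} {h₀} h≢h₀ h'≢h₀ same da db =
    ≤-antisym (dist-mono db da (shorten h' h h'≢h₀ (Equivalence.from same)))
              (dist-mono da db (shorten h h' h≢h₀ (Equivalence.to same)))
    where
    shorten : ∀ h₁ h₂ → h₁ ≢ h₀ → (Adj H h₁ h₀ → Adj H h₂ h₀) →
      ∀ m → Walk (G ⊙ H) (inj₂ (i , h₁)) (inj₂ (i , h₀)) m →
      Σ ℕ λ m' → m' ≤ m × Walk (G ⊙ H) (inj₂ (i , h₂)) (inj₂ (i , h₀)) m'
    shorten h₁ h₂ h₁≢h₀ _ zero walk = ⊥-elim (h₁≢h₀ (position-injective (walk₀-trivial walk)))
    shorten h₁ h₂ _ transfer (suc zero) walk with walk₁-edge walk
    ... | (same-copy , h₁h₀) = 1 , ≤-refl , cons (same-copy , transfer h₁h₀) nil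
    shorten h₁ h₂ _ _ (suc (suc m)) _ = 2 , s≤s (s≤s z≤n) , cons {w = inj₁ i} refl (cons refl nil)

  module Landmarks {d : ℕ} (S : Fin d → Vertex) (S-inj : ∀ {k l} → S k ≡ S l → k ≡ l)
    (resolving : IsResolvingSet (G ⊙ H) (S , S-inj)) {h h' : Fin n₂} (h≢h' : h ≢ h') where

    -- Every copy Hᵢ contains a landmark: (i,h) and (i,h') are resolved only from inside Hᵢ.
    landmark : ∀ i → Σ (Fin d) λ k → InCopy i (S k)
    landmark i with any? (λ k → inCopy? i (S k))
    ... | yes found = found
    ... | no none with resolving (inj₂ (i , h)) (inj₂ (i , h')) (h≢h' ∘ position-injective)
    ... | (k , a , b , da , db , a≢b) =
      ⊥-elim (a≢b (outside-distance-eq i h h' (λ k∈Hᵢ → none (k , k∈Hᵢ)) da db))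

    first : Fin n₁ → Fin d
    first i = proj₁ (landmark i)

    anchor : Fin n₁ → Fin n₂
    anchor i = proj₁ (proj₂ (landmark i))

    -- Distinct copies have distinct first landmarks, so n₁ ≤ d.
    n₁≤d : n₁ ≤ d
    n₁≤d = injective⇒≤ {f = first} λ {i} {j} eq →
      copy-unique (proj₂ (landmark i)) (subst (λ k → InCopy j (S k)) (sym eq) (proj₂ (landmark j)))

    SecondLandmark : Fin n₁ → Set
    SecondLandmark i = Σ (Fin d) λ k → k ≢ first i × InCopy i (S k)

    secondLandmark? : ∀ i → Dec (SecondLandmark i)
    secondLandmark? i = any? λ k → ¬? (k ≟ first i) ×-dec inCopy? i (S k)

    -- Decidable membership makes this case split constructive.
    two-everywhere-or-lone : (∀ i → SecondLandmark i) ⊎ (∃ λ i → ¬ SecondLandmark i)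
    two-everywhere-or-lone with all? secondLandmark?
    ... | yes everywhere = inj₁ everywhere
    ... | no notEverywhere = inj₂ (¬∀⟶∃¬ n₁ SecondLandmark secondLandmark? notEverywhere)

    two-landmarks-bound : (∀ i → SecondLandmark i) → n₁ + n₁ ≤ d
    two-landmarks-bound second = injective⇒≤ {f = pick ∘ splitAt n₁} λ eq →
      splitAt-injective (pick-injective eq)
      where
      pick : Fin n₁ ⊎ Fin n₁ → Fin d
      pick (inj₁ i) = first i
      pick (inj₂ i) = proj₁ (second i)

      owner : Fin n₁ ⊎ Fin n₁ → Fin n₁
      owner (inj₁ i) = i
      owner (inj₂ i) = i

      pick-in-owner : ∀ x → InCopy (owner x) (S (pick x))
      pick-in-owner (inj₁ i) = proj₂ (landmark i)
      pick-in-owner (inj₂ i) = proj₂ (proj₂ (second i))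

      same-owner : ∀ {x y} → pick x ≡ pick y → owner x ≡ owner y
      same-owner {x} {y} eq =
        copy-unique (pick-in-owner x) (subst (λ k → InCopy (owner y) (S k)) (sym eq) (pick-in-owner y))

      pick-injective : ∀ {x y} → pick x ≡ pick y → x ≡ y
      pick-injective {inj₁ i} {inj₁ j} eq = cong inj₁ (same-owner {inj₁ i} {inj₁ j} eq)
      pick-injective {inj₂ i} {inj₂ j} eq = cong inj₂ (same-owner {inj₂ i} {inj₂ j} eq)
      pick-injective {inj₁ i} {inj₂ j} eq with same-owner {inj₁ i} {inj₂ j} eq
      ... | refl = ⊥-elim (proj₁ (proj₂ (second i)) (sym eq))
      pick-injective {inj₂ i} {inj₁ j} eq with same-owner {inj₂ i} {inj₁ j} eq
      ... | refl = ⊥-elim (proj₁ (proj₂ (second i)) eq)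

      splitAt-injective : ∀ {x y} → splitAt n₁ x ≡ splitAt n₁ y → x ≡ y
      splitAt-injective {x} {y} eq =
        trans (sym (join-splitAt n₁ n₁ x)) (trans (cong (join n₁ n₁) eq) (join-splitAt n₁ n₁ y))

    lone-landmark : ∀ i → ¬ SecondLandmark i → ∀ k → InCopy i (S k) → S k ≡ inj₂ (i , anchor i)
    lone-landmark i lone k k∈Hᵢ with k ≟ first i
    ... | yes refl = proj₂ (proj₂ (landmark i))
    ... | no k≢first = ⊥-elim (lone (k , k≢first , k∈Hᵢ))

    lone-landmark-distinguishes : ∀ i → ¬ SecondLandmark i → DistinguishedBy H (anchor i)
    lone-landmark-distinguishes i lone a b a≢b a≢h₀ b≢h₀ same
      with resolving (inj₂ (i , a)) (inj₂ (i , b)) (a≢b ∘ position-injective)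
    ... | (k , x , y , dx , dy , x≢y) with inCopy? i (S k)
    ... | no k∉Hᵢ = x≢y (outside-distance-eq i a b k∉Hᵢ dx dy)
    ... | yes k∈Hᵢ = x≢y (inside-distance-eq i a≢h₀ b≢h₀ same
                           (subst (λ t → Dist (G ⊙ H) _ t x) at-anchor dx)
                           (subst (λ t → Dist (G ⊙ H) _ t y) at-anchor dy))
      where
      at-anchor : S k ≡ inj₂ (i , anchor i)
      at-anchor = lone-landmark i lone k k∈Hᵢ

other-of-two : (b c x : Fin 2) → b ≢ c → x ≢ b → x ≡ c
other-of-two zero       zero       _          b≢c _   = ⊥-elim (b≢c refl)
other-of-two zero       (suc zero) zero       _   x≢b = ⊥-elim (x≢b refl)
other-of-two zero       (suc zero) (suc zero) _   _   = refl
other-of-two (suc zero) zero       zero       _   _   = refl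
other-of-two (suc zero) zero       (suc zero) _   x≢b = ⊥-elim (x≢b refl)
other-of-two (suc zero) (suc zero) _          b≢c _   = ⊥-elim (b≢c refl)

other-of-three : (a b c x : Fin 3) → a ≢ b → a ≢ c → b ≢ c → x ≢ a → x ≢ b → x ≡ c
other-of-three a b c x a≢b a≢c b≢c x≢a x≢b =
  punchOut-injective a≢x a≢c (other-of-two (punchOut a≢b) (punchOut a≢c) (punchOut a≢x)
    (b≢c ∘ punchOut-injective a≢b a≢c) (x≢b ∘ punchOut-injective a≢x a≢b))
  where
  a≢x : a ≢ x
  a≢x = x≢a ∘ sym

connected-two≅P₂ : (H : Graph (Fin 2)) → Connected H → H ≅ P 2
connected-two≅P₂ H connected = mk↔ₛ′ (λ x → x) (λ x → x) (λ _ → refl) (λ _ → refl) , adjacency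
  where
  edge : Adj H zero (suc zero)
  edge with connected zero (suc zero)
  ... | (_ , cons {w = zero} loop _) = ⊥-elim (irrefl H loop)
  ... | (_ , cons {w = suc zero} e _) = e
  adjacency : ∀ u v → (Adj H u v → PAdj u v) × (PAdj u v → Adj H u v)
  adjacency zero zero = (⊥-elim ∘ irrefl H) , (⊥-elim ∘ P-irrefl {n = 2} {i = zero})
  adjacency zero (suc zero) = (λ _ → inj₁ refl) , (λ _ → edge)
  adjacency (suc zero) zero = (λ _ → inj₂ refl) , (λ _ → symm H edge)
  adjacency (suc zero) (suc zero) = (⊥-elim ∘ irrefl H) , (⊥-elim ∘ P-irrefl {n = 2} {i = suc zero})

path≅P₃ : (H : Graph (Fin 3)) {a b c : Fin 3} → a ≢ b → a ≢ c → b ≢ c →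
  Adj H a b → Adj H b c → ¬ Adj H a c → H ≅ P 3
path≅P₃ H {a} {b} {c} a≢b a≢c b≢c ab bc a≁c = mk↔ₛ′ index vertex index-vertex vertex-index , adjacency
  where
  vertex : Fin 3 → Fin 3
  vertex zero = a
  vertex (suc zero) = b
  vertex (suc (suc zero)) = c

  index : Fin 3 → Fin 3
  index x with x ≟ a | x ≟ b
  ... | yes _ | _ = zero
  ... | no _ | yes _ = suc zero
  ... | no _ | no _ = suc (suc zero)

  vertex-index : ∀ x → vertex (index x) ≡ x
  vertex-index x with x ≟ a | x ≟ b
  ... | yes x≡a | _ = sym x≡a
  ... | no _ | yes x≡b = sym x≡b
  ... | no x≢a | no x≢b = sym (other-of-three a b c x a≢b a≢c b≢c x≢a x≢b)

  index-vertex : ∀ i → index (vertex i) ≡ i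
  index-vertex zero with a ≟ a
  ... | yes _ = refl
  ... | no a≢a = ⊥-elim (a≢a refl)
  index-vertex (suc zero) with b ≟ a | b ≟ b
  ... | yes b≡a | _ = ⊥-elim (a≢b (sym b≡a))
  ... | no _ | yes _ = refl
  ... | no _ | no b≢b = ⊥-elim (b≢b refl)
  index-vertex (suc (suc zero)) with c ≟ a | c ≟ b
  ... | yes c≡a | _ = ⊥-elim (a≢c (sym c≡a))
  ... | no _ | yes c≡b = ⊥-elim (b≢c (sym c≡b))
  ... | no _ | no _ = refl

  positions : ∀ i j → (Adj H (vertex i) (vertex j) → PAdj i j) × (PAdj i j → Adj H (vertex i) (vertex j))
  positions zero zero = (⊥-elim ∘ irrefl H) , λ { (inj₁ ()) ; (inj₂ ()) }
  positions zero (suc zero) = (λ _ → inj₁ refl) , λ _ → ab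
  positions zero (suc (suc zero)) = (⊥-elim ∘ a≁c) , λ { (inj₁ ()) ; (inj₂ ()) }
  positions (suc zero) zero = (λ _ → inj₂ refl) , λ _ → symm H ab
  positions (suc zero) (suc zero) = (⊥-elim ∘ irrefl H) , λ { (inj₁ ()) ; (inj₂ ()) }
  positions (suc zero) (suc (suc zero)) = (λ _ → inj₁ refl) , λ _ → bc
  positions (suc (suc zero)) zero = (⊥-elim ∘ a≁c ∘ symm H) , λ { (inj₁ ()) ; (inj₂ ()) }
  positions (suc (suc zero)) (suc zero) = (λ _ → inj₂ refl) , λ _ → symm H bc
  positions (suc (suc zero)) (suc (suc zero)) = (⊥-elim ∘ irrefl H) , λ { (inj₁ ()) ; (inj₂ ()) }

  adjacency : ∀ u v → (Adj H u v → PAdj (index u) (index v)) × (PAdj (index u) (index v) → Adj H u v)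
  adjacency u v =
    (λ uv → proj₁ (positions (index u) (index v)) (subst₂ (Adj H) (sym (vertex-index u)) (sym (vertex-index v)) uv)) ,
    (λ p → subst₂ (Adj H) (vertex-index u) (vertex-index v) (proj₂ (positions (index u) (index v)) p))

-- A connected graph on three vertices in which h₀ is adjacent to b but not to c is the path
-- c - b - h₀: the first step of a walk from c to h₀ can only go to b.
one-neighbour≅P₃ : (H : Graph (Fin 3)) → Connected H → {h₀ b c : Fin 3} → b ≢ h₀ → c ≢ h₀ → b ≢ c →
  Adj H b h₀ → ¬ Adj H c h₀ → H ≅ P 3
one-neighbour≅P₃ H connected {h₀} {b} {c} b≢h₀ c≢h₀ b≢c bh₀ c≁h₀ =
  path≅P₃ H (b≢c ∘ sym) c≢h₀ b≢h₀ cb bh₀ c≁h₀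
  where
  cb : Adj H c b
  cb with connected c h₀
  ... | (zero , walk) = ⊥-elim (c≢h₀ (walk₀-trivial walk))
  ... | (suc _ , cons {w = z} cz _) = subst (Adj H c) z≡b cz
    where
    z≡b : z ≡ b
    z≡b = other-of-three h₀ c b z (c≢h₀ ∘ sym) (b≢h₀ ∘ sym) (b≢c ∘ sym)
      (λ z≡h₀ → c≁h₀ (subst (Adj H c) z≡h₀ cz)) (λ z≡c → irrefl H (subst (Adj H c) z≡c cz))

distinguished-others : ∀ {n} (H : Graph (Fin (suc n))) {h₀} → DistinguishedBy H h₀ →
  ∀ j j' → j ≢ j' → ¬ (Adj H (punchIn h₀ j) h₀ ⇔ Adj H (punchIn h₀ j') h₀)
distinguished-others H {h₀} distinguished j j' j≢j' =
  distinguished _ _ (j≢j' ∘ punchIn-injective h₀ j j') (punchInᵢ≢i h₀ j) (punchInᵢ≢i h₀ j')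

-- A connected graph on at least two vertices with a vertex h₀ distinguishing all other
-- vertices is P₂ or P₃: adjacency to h₀ takes only two values, so at most two other vertices.
¬¬-P₂-or-P₃ : ∀ {n} (H : Graph (Fin n)) → 2 ≤ n → Connected H → (h₀ : Fin n) →
  DistinguishedBy H h₀ → ¬ ¬ (H ≅ P 2 ⊎ H ≅ P 3)
¬¬-P₂-or-P₃ {suc zero} _ (s≤s ()) _ _ _
¬¬-P₂-or-P₃ {suc (suc zero)} H _ connected _ _ = pure (inj₁ (connected-two≅P₂ H connected))
¬¬-P₂-or-P₃ {suc (suc (suc zero))} H _ connected h₀ distinguished =
  ¬¬-excluded-middle >>= λ b? → ¬¬-excluded-middle >>= λ c? →
  pure (inj₂ (by-status (one-of-two b? c? (distinguished-others H distinguished zero (suc zero) λ ()))))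
  where
  b c : Fin 3
  b = punchIn h₀ zero
  c = punchIn h₀ (suc zero)
  b≢c : b ≢ c
  b≢c = (λ ()) ∘ punchIn-injective h₀ zero (suc zero)
  by-status : (Adj H b h₀ × ¬ Adj H c h₀) ⊎ (¬ Adj H b h₀ × Adj H c h₀) → H ≅ P 3
  by-status (inj₁ (bh₀ , c≁h₀)) =
    one-neighbour≅P₃ H connected (punchInᵢ≢i h₀ zero) (punchInᵢ≢i h₀ (suc zero)) b≢c bh₀ c≁h₀
  by-status (inj₂ (b≁h₀ , ch₀)) =
    one-neighbour≅P₃ H connected (punchInᵢ≢i h₀ (suc zero)) (punchInᵢ≢i h₀ zero) (b≢c ∘ sym) ch₀ b≁h₀
¬¬-P₂-or-P₃ {suc (suc (suc (suc _)))} H _ _ h₀ distinguished =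
  ¬¬-excluded-middle >>= λ x₀? → ¬¬-excluded-middle >>= λ x₁? → ¬¬-excluded-middle >>= λ x₂? →
  ⊥-elim (no-three-inequivalent x₀? x₁? x₂?
    (distinguished-others H distinguished zero (suc zero) λ ())
    (distinguished-others H distinguished zero (suc (suc zero)) λ ())
    (distinguished-others H distinguished (suc zero) (suc (suc zero)) λ ()))

complete-corona-≅ : ∀ {n₁ n₂ n₂'} (G : Graph (Fin n₁)) {H : Graph (Fin n₂)} {H' : Graph (Fin n₂')} →
  Complete G → H ≅ H' → (G ⊙ H) ≅ (K n₁ ⊙ H')
complete-corona-≅ {n₁} {n₂} {n₂'} G {H} {H'} complete (ψ , ψ-adjacency) =
  mk↔ₛ′ to' from' to-from from-to , adjacency
  where
  open Inverse ψ using (to; from; strictlyInverseˡ; strictlyInverseʳ)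

  to' : Fin n₁ ⊎ (Fin n₁ × Fin n₂) → Fin n₁ ⊎ (Fin n₁ × Fin n₂')
  to' (inj₁ i) = inj₁ i
  to' (inj₂ (i , h)) = inj₂ (i , to h)

  from' : Fin n₁ ⊎ (Fin n₁ × Fin n₂') → Fin n₁ ⊎ (Fin n₁ × Fin n₂)
  from' (inj₁ i) = inj₁ i
  from' (inj₂ (i , h)) = inj₂ (i , from h)

  to-from : ∀ y → to' (from' y) ≡ y
  to-from (inj₁ i) = refl
  to-from (inj₂ (i , h)) = cong (λ z → inj₂ (i , z)) (strictlyInverseˡ h)

  from-to : ∀ x → from' (to' x) ≡ x
  from-to (inj₁ i) = refl
  from-to (inj₂ (i , h)) = cong (λ z → inj₂ (i , z)) (strictlyInverseʳ h)

  adjacency : ∀ u v → (Adj (G ⊙ H) u v → Adj (K n₁ ⊙ H') (to' u) (to' v)) ×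
                      (Adj (K n₁ ⊙ H') (to' u) (to' v) → Adj (G ⊙ H) u v)
  adjacency (inj₁ i) (inj₁ j) = (λ ij i≡j → irrefl G (subst (Adj G i) (sym i≡j) ij)) , complete i j
  adjacency (inj₁ i) (inj₂ _) = (λ e → e) , (λ e → e)
  adjacency (inj₂ _) (inj₁ j) = (λ e → e) , (λ e → e)
  adjacency (inj₂ (_ , h)) (inj₂ (_ , h')) =
    (λ (e , hh') → e , proj₁ (ψ-adjacency h h') hh') , (λ (e , hh') → e , proj₂ (ψ-adjacency h h') hh')

path-bound : ∀ {n p d} → p ≤ n ∸ 1 → n ≤ d → n * p ≤ (n ∸ 1) * d
path-bound {n} {p} {d} p≤n-1 n≤d = begin
  n * p        ≤⟨ *-monoʳ-≤ n p≤n-1 ⟩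
  n * (n ∸ 1)  ≡⟨ *-comm n (n ∸ 1) ⟩
  (n ∸ 1) * n  ≤⟨ *-monoʳ-≤ (n ∸ 1) n≤d ⟩
  (n ∸ 1) * d  ∎
  where open ≤-Reasoning

-- n·p ≤ (n-1)·d when 2 ≤ n, p ≤ n and 2n ≤ d, since n² ≤ (n-1)·2n.
complete-bound : ∀ {n p d} → 2 ≤ n → p ≤ n → n + n ≤ d → n * p ≤ (n ∸ 1) * d
complete-bound {suc zero} (s≤s ()) _ _
complete-bound {suc (suc k)} {p} {d} _ p≤n 2n≤d = begin
  n * p            ≤⟨ *-monoʳ-≤ n p≤n ⟩
  n * n            ≤⟨ m≤m+n (n * n) (k * n) ⟩
  n * n + k * n    ≡⟨ square-identity k ⟩
  suc k * (n + n)  ≤⟨ *-monoʳ-≤ (suc k) 2n≤d ⟩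
  suc k * d        ∎
  where
  open ≤-Reasoning
  n : ℕ
  n = suc (suc k)
  square-identity : ∀ k → (2 + k) * (2 + k) + k * (2 + k) ≡ (1 + k) * ((2 + k) + (2 + k))
  square-identity = solve 1 (λ k → (con 2 :+ k) :* (con 2 :+ k) :+ k :* (con 2 :+ k)
                                 := (con 1 :+ k) :* ((con 2 :+ k) :+ (con 2 :+ k))) refl
    where open +-*-Solver

proposition3 : ∀ {n₁ n₂ : ℕ} (G : Graph (Fin n₁)) (H : Graph (Fin n₂)) →
    2 ≤ n₁ → 2 ≤ n₂ → Connected G → Connected H →
    ¬ ((G ⊙ H) ≅ (K n₁ ⊙ P 2)) → ¬ ((G ⊙ H) ≅ (K n₁ ⊙ P 3)) →
    ∀ (d p : ℕ) → IsMetricDim (G ⊙ H) d → IsPartitionDim G p →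
    n₁ * p ≤ (n₁ ∸ 1) * d
proposition3 {suc (suc k)} {suc (suc _)} G H 2≤n₁ 2≤n₂ connG connH ≇K⊙P₂ ≇K⊙P₃ d p
             (((S , S-inj) , resolving) , _) pdG =
  decidable-stable (_ ≤? _) (¬¬-excluded-middle {A = InducedPath G} >>= λ where
    (yes path) → pure (path-bound (pd-induced-path G connG path pdG) n₁≤d)
    (no noPath) → ¬¬-complete G connG noPath >>= complete-case)
  where
  open Corona G H
  open Landmarks S S-inj resolving {zero} {suc zero} (λ ())

  complete-case : Complete G → ¬ ¬ (suc (suc k) * p ≤ suc k * d)
  complete-case complete with two-everywhere-or-lone
  ... | inj₁ two = pure (complete-bound 2≤n₁ (pd≤order G connG pdG) (two-landmarks-bound two))
  ... | inj₂ (i , lone) =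
    ¬¬-P₂-or-P₃ H 2≤n₂ connH (anchor i) (lone-landmark-distinguishes i lone) >>= λ where
      (inj₁ H≅P₂) → ⊥-elim (≇K⊙P₂ (complete-corona-≅ G complete H≅P₂))
      (inj₂ H≅P₃) → ⊥-elim (≇K⊙P₃ (complete-corona-≅ G complete H≅P₃))
proposition3 {zero} _ _ () _ _ _ _ _ _ _ _ _
proposition3 {suc zero} _ _ (s≤s ()) _ _ _ _ _ _ _ _ _
proposition3 {suc (suc _)} {zero} _ _ _ () _ _ _ _ _ _ _ _
proposition3 {suc (suc _)} {suc zero} _ _ _ (s≤s ()) _ _ _ _ _ _ _ _
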